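{- For every integer $k > 1$, $\mathrm{DTIME}[\log^k n] \subsetneq \mathrm{DTIME}[\log^{k+1} n]$.
   Context: Throughout, $\log n$ denotes $\log_2 n$ and $\log^k n$ denotes $(\log n)^k$. A random-access Turing machine is a multi-tape Turing machine with (1) a read-only random-access input of length $n+1$ whose first $n$ cells contain the input binary string (each cell $0$ or $1$) and whose $(n+1)$-st cell contains an endmark $\triangleleft$, (2) a fixed number of read-write working tapes, and (3) a read-write input address-tape of length $\lceil \log n\rceil$ containing bits; at each step the binary number on the address-tape determines the input cell that is read, and if this number exceeds $n$ the endmark cell is read. For a function $f$, $\mathrm{DTIME}[f(n)]$ is the class of languages of binary strings accepted by a deterministic random-access Turing machine that makes at most $O(f(n))$ steps on inputs of length $n$. -}

module Defs where

open import Data.Nat using (ℕ; zero; suc; _+_; _*_; _^_; _≤_; _<_; _<?_)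
open import Data.Nat.Logarithm using (⌈log₂_⌉)
open import Data.Bool using (Bool; true; false; if_then_else_)
open import Data.Fin using (Fin; _≟_)
open import Data.List using (List; []; _∷_; length)
open import Data.Product using (Σ; _×_; _,_; ∃; proj₁; proj₂)
open import Relation.Nullary using (¬_; yes; no)
open import Relation.Binary.PropositionalEquality using (_≡_)
open import Function using (id)

data InSym : Set where
  bit : Bool → InSym
  endmark : InSym

data Move : Set where
  left stay right : Move

-- Q states (Fin Q), work alphabet Fin (suc Γ) with blank = zero,
--   k read-write working tapes (one-way infinite, cells indexed by ℕ),
--   one binary address tape of length ⌈log₂ n⌉.
-- The transition reads: current state, input symbol at the addressed cell,
-- bit under the address-tape head, symbols under the work heads; it returns:
-- new state, bit written on address tape and address-head move, and for every
-- work tape a symbol written and a move.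
record RATM : Set where
  field
    Q Γ k   : ℕ
    start   : Fin Q
    halting : Fin Q → Bool
    accepting : Fin Q → Bool
    δ : Fin Q → InSym → Bool → (Fin k → Fin (suc Γ)) →
        Fin Q × (Bool × Move) × (Fin k → Fin (suc Γ) × Move)

readInput : List Bool → ℕ → InSym
readInput []       _       = endmark
readInput (x ∷ xs) zero    = bit x
readInput (x ∷ xs) (suc a) = readInput xs a

-- Binary number on the first L cells of the address tape
-- (cell i has weight 2^i).
addrVal : (ℕ → Bool) → ℕ → ℕ
addrVal t zero    = 0
addrVal t (suc L) = addrVal t L + (if t L then 2 ^ L else 0)

update : {A : Set} → (ℕ → A) → ℕ → A → (ℕ → A)
update t p a i with i Data.Nat.≟ p
  where import Data.Nat
... | yes _ = a
... | no  _ = t i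

moveHead : Move → ℕ → ℕ
moveHead left  zero    = zero
moveHead left  (suc p) = p
moveHead stay  p       = p
moveHead right p       = suc p

moveBounded : ℕ → Move → ℕ → ℕ
moveBounded L m p with moveHead m p <? L
... | yes _ = moveHead m p
... | no  _ = p

record Config (M : RATM) : Set where
  open RATM M
  field
    state  : Fin Q
    addr   : ℕ → Bool
    ahead  : ℕ
    tapes  : Fin k → ℕ → Fin (suc Γ)
    heads  : Fin k → ℕ

module _ (M : RATM) where
  open RATM M
  open Config

  initConfig : Config M
  initConfig = record
    { state = start ; addr = λ _ → false ; ahead = 0
    ; tapes = λ _ _ → Fin.zero ; heads = λ _ → 0 }
    where import Data.Fin as Fin

  step : List Bool → Config M → Config M
  step w c with halting (state c)
  ... | true  = c
  ... | false =
    let L   = ⌈log₂ length w ⌉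
        ins = readInput w (addrVal (addr c) L)
        ab  = addr c (ahead c)
        ws  = λ j → tapes c j (heads c j)
        r   = δ (state c) ins ab ws
        q′  = proj₁ r
        ab′ = proj₁ (proj₁ (proj₂ r))
        am  = proj₂ (proj₁ (proj₂ r))
        wo  = proj₂ (proj₂ r)
    in record
      { state = q′
      ; addr  = writeAddr L (addr c) (ahead c) ab′
      ; ahead = moveBounded L am (ahead c)
      ; tapes = λ j → update (tapes c j) (heads c j) (proj₁ (wo j))
      ; heads = λ j → moveHead (proj₂ (wo j)) (heads c j) }
    where
      writeAddr : ℕ → (ℕ → Bool) → ℕ → Bool → (ℕ → Bool)
      writeAddr L t p b with p <? L
      ... | yes _ = update t p b
      ... | no  _ = t

  run : List Bool → ℕ → Config M
  run w zero    = initConfig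
  run w (suc t) = step w (run w t)

  HaltsWithin : List Bool → ℕ → Bool → Set
  HaltsWithin w t b =
    Σ ℕ λ s → s ≤ t × halting (state (run w s)) ≡ true
                    × accepting (state (run w s)) ≡ b

Language : Set
Language = List Bool → Bool

-- L ∈ DTIME[f(n)]: some RATM decides L making at most O(f(n)) steps
-- (at most c·f(n) + c steps on every input of length n).
DTIME : (ℕ → ℕ) → Language → Set
DTIME f L = Σ RATM λ M → Σ ℕ λ c →
  ∀ (w : List Bool) → HaltsWithin M w (c * f (length w) + c) (L w)

logPow : ℕ → ℕ → ℕ
logPow k n = ⌈log₂ n ⌉ ^ k

module Submission where

-- Inclusion is monotonicity of the time bound. For the separation, a machine with no work tapes
-- and L = ⌈log n⌉ address bits first sets the top address bit (it finds the end of the address tape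
-- by writing ones until a move fails) and then runs through all ways of setting k + 1 of the other
-- bits, reading the input at every step: it accepts as soon as it reads a one and rejects when the
-- enumeration is exhausted, after O(L^(k+1)) steps. Conversely, let D = c (2k + 2)^k + c and
-- L = (k + 1)(D + 1) + 1. On the zero word of length n = 2^L, a machine running in time
-- c log^k n + c queries fewer addresses than the (D + 1)^(k+1) candidates with one set bit in each of
-- k + 1 blocks of width D + 1 below the top bit. Setting the input bit at a missed candidate to one
-- puts the word into the language without changing the run, so that machine errs on one of the two words.

open import Defs
open import Data.Bool using (Bool; true; false; T; if_then_else_)
open import Data.Empty using (⊥; ⊥-elim)
open import Data.Fin as Fin using (Fin; toℕ; fromℕ<; remQuot; combine)
open import Data.Fin.Properties using (toℕ-fromℕ<; toℕ-injective; toℕ<n; combine-remQuot; pigeonhole; any?; ¬∀⟶∃¬)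
open import Data.List using (List; []; _∷_; length; replicate)
open import Data.List.Properties using (length-replicate)
open import Data.List.Relation.Unary.All using (All; []; _∷_)
open import Data.Nat
open import Data.Nat.Logarithm using (⌈log₂_⌉; ⌈log₂2^n⌉≡n)
open import Data.Nat.Properties
open import Data.Nat.Tactic.RingSolver using (solve-∀)
open import Data.Product using (Σ; ∃; _×_; _,_; proj₁; proj₂; uncurry)
open import Data.Sum using (_⊎_; inj₁; inj₂)
open import Data.Unit using (⊤; tt)
open import Relation.Binary.PropositionalEquality
open import Function using (_∘_)
open import Relation.Nullary using (¬_; yes; no; contradiction)

-- Arithmetic and tapes

1≤^ : ∀ {X} j → 1 ≤ X → 1 ≤ X ^ j
1≤^ zero    _   = ≤-refl
1≤^ (suc j) 1≤X = *-mono-≤ 1≤X (1≤^ j 1≤X)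

≤^suc : ∀ {X} j → 1 ≤ X → X ≤ X ^ suc j
≤^suc {X} j 1≤X = subst (_≤ X ^ suc j) (*-identityʳ X) (*-monoʳ-≤ X (1≤^ j 1≤X))

^-distribʳ-* : ∀ a b n → (a * b) ^ n ≡ a ^ n * b ^ n
^-distribʳ-* a b zero    = refl
^-distribʳ-* a b (suc n) = trans (cong (a * b *_) (^-distribʳ-* a b n)) (interchange a b (a ^ n) (b ^ n))
  where
    interchange : ∀ a b x y → a * b * (x * y) ≡ a * x * (b * y)
    interchange = solve-∀

module _ {A : Set} where

  update-≡ : ∀ (t : ℕ → A) p a → update t p a p ≡ a
  update-≡ t p a with p ≟ p
  ... | yes _   = refl
  ... | no p≢p  = contradiction refl p≢p

  update-≢ : ∀ (t : ℕ → A) {p} a {i} → i ≢ p → update t p a i ≡ t i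
  update-≢ t {p} a {i} i≢p with i ≟ p
  ... | yes i≡p = contradiction i≡p i≢p
  ... | no _    = refl

  update-elim : ∀ (P : A → Set) (t : ℕ → A) p a {i} → P a → (i ≢ p → P (t i)) → P (update t p a i)
  update-elim P t p a {i} pa pt with i ≟ p
  ... | yes _   = pa
  ... | no i≢p  = pt i≢p

  update-cong : ∀ {t t′ : ℕ → A} p a → t ≗ t′ → update t p a ≗ update t′ p a
  update-cong p a t≗t′ i with i ≟ p
  ... | yes _ = refl
  ... | no _  = t≗t′ i

  update-id : ∀ (t : ℕ → A) p {a} → t p ≡ a → update t p a ≗ t
  update-id t p tp≡a i with i ≟ p
  ... | yes refl = sym tp≡a
  ... | no _     = refl

  update-update : ∀ (t : ℕ → A) p a b → update (update t p a) p b ≗ update t p b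
  update-update t p a b i with i ≟ p
  ... | yes _   = refl
  ... | no i≢p  = update-≢ t a i≢p

addrVal-cong : ∀ {t t′} L → t ≗ t′ → addrVal t L ≡ addrVal t′ L
addrVal-cong zero    t≗t′ = refl
addrVal-cong (suc L) t≗t′ =
  cong₂ (λ v b → v + (if b then 2 ^ L else 0)) (addrVal-cong L t≗t′) (t≗t′ L)

addrVal-< : ∀ t L → addrVal t L < 2 ^ L
addrVal-< t zero = s≤s z≤n
addrVal-< t (suc L) with t L
... | true  = begin-strict
    addrVal t L + 2 ^ L   <⟨ +-monoˡ-< (2 ^ L) (addrVal-< t L) ⟩
    2 ^ L + 2 ^ L         ≡⟨ cong (2 ^ L +_) (sym (+-identityʳ (2 ^ L))) ⟩
    2 ^ suc L             ∎
  where open ≤-Reasoning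
... | false = begin-strict
    addrVal t L + 0       ≡⟨ +-identityʳ _ ⟩
    addrVal t L           <⟨ addrVal-< t L ⟩
    2 ^ L                 ≤⟨ m≤m+n (2 ^ L) _ ⟩
    2 ^ suc L             ∎
  where open ≤-Reasoning

addrVal-top≢ : ∀ t t′ L → addrVal t L + 2 ^ L ≢ addrVal t′ L + 0
addrVal-top≢ t t′ L eq =
  <-irrefl (trans (sym (+-identityʳ _)) (sym eq))
           (≤-trans (addrVal-< t′ L) (m≤n+m (2 ^ L) (addrVal t L)))

addrVal-suc-injective : ∀ t t′ L → addrVal t (suc L) ≡ addrVal t′ (suc L) →
                        addrVal t L ≡ addrVal t′ L × t L ≡ t′ L
addrVal-suc-injective t t′ L eq with t L | t′ L
... | true  | true  = +-cancelʳ-≡ _ _ _ eq , refl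
... | false | false = +-cancelʳ-≡ _ _ _ eq , refl
... | true  | false = contradiction eq (addrVal-top≢ t t′ L)
... | false | true  = contradiction (sym eq) (addrVal-top≢ t′ t L)

addrVal-injective : ∀ L t t′ → addrVal t L ≡ addrVal t′ L → ∀ {x} → x < L → t x ≡ t′ x
addrVal-injective (suc L) t t′ eq x<1+L with m≤n⇒m<n∨m≡n (≤-pred x<1+L)
... | inj₁ x<L  = addrVal-injective L t t′ (proj₁ (addrVal-suc-injective t t′ L eq)) x<L
... | inj₂ refl = proj₂ (addrVal-suc-injective t t′ L eq)

moveBounded-< : ∀ {L} mv h → moveHead mv h < L → moveBounded L mv h ≡ moveHead mv h
moveBounded-< {L} mv h lt with moveHead mv h <? L
... | yes _  = refl
... | no ≮L  = contradiction lt ≮L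

moveBounded-≮ : ∀ {L} mv h → ¬ moveHead mv h < L → moveBounded L mv h ≡ h
moveBounded-≮ {L} mv h ≮L with moveHead mv h <? L
... | yes lt = contradiction lt ≮L
... | no _   = refl

-- Runs of random-access machines

addrLength : List Bool → ℕ
addrLength w = ⌈log₂ length w ⌉

module Runs (M : RATM) where
  open RATM M
  open Config

  stepN : List Bool → ℕ → Config M → Config M
  stepN w zero    c = c
  stepN w (suc t) c = stepN w t (step M w c)

  stepN-+ : ∀ w s t c → stepN w (s + t) c ≡ stepN w t (stepN w s c)
  stepN-+ w zero    t c = refl
  stepN-+ w (suc s) t c = stepN-+ w s t (step M w c)

  run≡stepN : ∀ w t → run M w t ≡ stepN w t (initConfig M)
  run≡stepN w zero    = refl
  run≡stepN w (suc t) = begin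
    step M w (run M w t)                  ≡⟨ cong (step M w) (run≡stepN w t) ⟩
    stepN w 1 (stepN w t (initConfig M))  ≡⟨ sym (stepN-+ w t 1 _) ⟩
    stepN w (t + 1) (initConfig M)        ≡⟨ cong (λ s → stepN w s (initConfig M)) (+-comm t 1) ⟩
    stepN w (suc t) (initConfig M)        ∎
    where open ≡-Reasoning

  step-halted : ∀ w c → halting (state c) ≡ true → step M w c ≡ c
  step-halted w c h with halting (state c)
  step-halted w c refl | true = refl

  run-halted : ∀ w {s t} → halting (state (run M w s)) ≡ true → s ≤ t → run M w t ≡ run M w s
  run-halted w {s} {t} h s≤t = trans (cong (run M w) (sym (m∸n+n≡m s≤t))) (later (t ∸ s))
    where
      later : ∀ d → run M w (d + s) ≡ run M w s
      later zero    = refl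
      later (suc d) = trans (cong (step M w) (later d)) (step-halted w _ h)

  HaltsWithin⇒accepting : ∀ {w t b} → HaltsWithin M w t b → accepting (state (run M w t)) ≡ b
  HaltsWithin⇒accepting {w} (s , s≤t , h , acc) = trans (cong (λ c → accepting (state c)) (run-halted w h s≤t)) acc

  readAt : List Bool → Config M → InSym
  readAt w c = readInput w (addrVal (addr c) (addrLength w))

  transition : List Bool → Config M → Fin Q × (Bool × Move) × (Fin k → Fin (suc Γ) × Move)
  transition w c = δ (state c) (readAt w c) (addr c (ahead c)) (λ j → tapes c j (heads c j))

  module _ (w : List Bool) (c : Config M) (running : halting (state c) ≡ false) where
    private
      r = transition w c

    step-state : state (step M w c) ≡ proj₁ r
    step-state with halting (state c)
    ... | false = refl

    step-ahead : ahead (step M w c) ≡ moveBounded (addrLength w) (proj₂ (proj₁ (proj₂ r))) (ahead c)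
    step-ahead with halting (state c)
    ... | false = refl

    step-addr-< : ahead c < addrLength w → addr (step M w c) ≡ update (addr c) (ahead c) (proj₁ (proj₁ (proj₂ r)))
    step-addr-< h<L with halting (state c)
    ... | false with ahead c <? addrLength w
    ...   | yes _  = refl
    ...   | no h≮L = contradiction h<L h≮L

    step-addr-≮ : ¬ ahead c < addrLength w → addr (step M w c) ≡ addr c
    step-addr-≮ h≮L with halting (state c)
    ... | false with ahead c <? addrLength w
    ...   | yes h<L = contradiction h<L h≮L
    ...   | no _    = refl

    step-tapes : tapes (step M w c) ≡ λ j → update (tapes c j) (heads c j) (proj₁ (proj₂ (proj₂ r) j))
    step-tapes with halting (state c)
    ... | false = refl

    step-heads : heads (step M w c) ≡ λ j → moveHead (proj₂ (proj₂ (proj₂ r) j)) (heads c j)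
    step-heads with halting (state c)
    ... | false = refl

  config-≡ : ∀ {c c′ : Config M} → state c ≡ state c′ → addr c ≡ addr c′ → ahead c ≡ ahead c′ →
             tapes c ≡ tapes c′ → heads c ≡ heads c′ → c ≡ c′
  config-≡ refl refl refl refl refl = refl

  step-input-cong : ∀ {w w′} c → length w ≡ length w′ → readAt w c ≡ readAt w′ c → step M w c ≡ step M w′ c
  step-input-cong {w} {w′} c len rd = byHalting (halting (state c)) refl
    where
      L≡ : addrLength w ≡ addrLength w′
      L≡ = cong ⌈log₂_⌉ len
      r≡ : transition w c ≡ transition w′ c
      r≡ = cong (λ x → δ (state c) x (addr c (ahead c)) (λ j → tapes c j (heads c j))) rd
      addr≡ : halting (state c) ≡ false → addr (step M w c) ≡ addr (step M w′ c)
      addr≡ h with ahead c <? addrLength w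
      ... | yes h<L = trans (step-addr-< w c h h<L)
                       (trans (cong (λ x → update (addr c) (ahead c) (proj₁ (proj₁ (proj₂ x)))) r≡)
                              (sym (step-addr-< w′ c h (subst (ahead c <_) L≡ h<L))))
      ... | no h≮L  = trans (step-addr-≮ w c h h≮L) (sym (step-addr-≮ w′ c h (h≮L ∘ subst (ahead c <_) (sym L≡))))
      byHalting : ∀ b → halting (state c) ≡ b → step M w c ≡ step M w′ c
      byHalting true  h = trans (step-halted w c h) (sym (step-halted w′ c h))
      byHalting false h = config-≡
        (trans (step-state w c h) (trans (cong proj₁ r≡) (sym (step-state w′ c h))))
        (addr≡ h)
        (trans (step-ahead w c h) (trans (cong₂ (λ L x → moveBounded L (proj₂ (proj₁ (proj₂ x))) (ahead c)) L≡ r≡)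
                                          (sym (step-ahead w′ c h))))
        (trans (step-tapes w c h) (trans (cong (λ x j → update (tapes c j) (heads c j) (proj₁ (proj₂ (proj₂ x) j))) r≡)
                                          (sym (step-tapes w′ c h))))
        (trans (step-heads w c h) (trans (cong (λ x j → moveHead (proj₂ (proj₂ (proj₂ x) j)) (heads c j)) r≡)
                                          (sym (step-heads w′ c h))))

  run-input-cong : ∀ {w w′ T} → length w′ ≡ length w →
    (∀ s → s < T → readAt w′ (run M w s) ≡ readAt w (run M w s)) →
    ∀ s → s ≤ T → run M w′ s ≡ run M w s
  run-input-cong len agree zero    _   = refl
  run-input-cong {w} {w′} len agree (suc s) s<T =
    trans (cong (step M w′) (run-input-cong len agree s (<⇒≤ s<T)))
          (step-input-cong (run M w s) len (agree s s<T))

  HaltsWithin-indistinguishable : ∀ {w w′ t b b′} → length w′ ≡ length w →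
    (∀ s → s < t → readAt w′ (run M w s) ≡ readAt w (run M w s)) →
    HaltsWithin M w′ t b′ → HaltsWithin M w t b → b′ ≡ b
  HaltsWithin-indistinguishable {w} {w′} {t} len agree halts′ halts = begin
    _                             ≡⟨ sym (HaltsWithin⇒accepting halts′) ⟩
    accepting (state (run M w′ t)) ≡⟨ cong (accepting ∘ state) (run-input-cong len agree t ≤-refl) ⟩
    accepting (state (run M w t))  ≡⟨ HaltsWithin⇒accepting halts ⟩
    _                             ∎
    where open ≡-Reasoning

-- Inputs and address patterns

zeros : ℕ → List Bool
zeros n = replicate n false

isOne : InSym → Bool
isOne (bit b) = b
isOne endmark = false

isOne-zeros : ∀ n x → isOne (readInput (zeros n) x) ≡ false
isOne-zeros zero    x       = refl
isOne-zeros (suc n) zero    = refl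
isOne-zeros (suc n) (suc x) = isOne-zeros n x

readInput-zeros-or-one : ∀ w x → readInput w x ≡ readInput (zeros (length w)) x ⊎ readInput w x ≡ bit true
readInput-zeros-or-one []          x       = inj₁ refl
readInput-zeros-or-one (false ∷ w) zero    = inj₁ refl
readInput-zeros-or-one (true ∷ w)  zero    = inj₂ refl
readInput-zeros-or-one (b ∷ w)     (suc x) = readInput-zeros-or-one w x

setOne : List Bool → ℕ → List Bool
setOne []      d       = []
setOne (b ∷ w) zero    = true ∷ w
setOne (b ∷ w) (suc d) = b ∷ setOne w d

length-setOne : ∀ w d → length (setOne w d) ≡ length w
length-setOne []      d       = refl
length-setOne (b ∷ w) zero    = refl
length-setOne (b ∷ w) (suc d) = cong suc (length-setOne w d)

readInput-setOne-≢ : ∀ w {d x} → x ≢ d → readInput (setOne w d) x ≡ readInput w x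
readInput-setOne-≢ []      {d}     {x}     x≢d = refl
readInput-setOne-≢ (b ∷ w) {zero}  {zero}  x≢d = contradiction refl x≢d
readInput-setOne-≢ (b ∷ w) {zero}  {suc x} x≢d = refl
readInput-setOne-≢ (b ∷ w) {suc d} {zero}  x≢d = refl
readInput-setOne-≢ (b ∷ w) {suc d} {suc x} x≢d = readInput-setOne-≢ w (x≢d ∘ cong suc)

readInput-setOne-≡ : ∀ w {d} → d < length w → readInput (setOne w d) d ≡ bit true
readInput-setOne-≡ (b ∷ w) {zero}  _         = refl
readInput-setOne-≡ (b ∷ w) {suc d} (s≤s d<n) = readInput-setOne-≡ w d<n

-- Ascending lo U j ps : ps lists j + 1 strictly increasing positions in [lo, U).
data Ascending : ℕ → ℕ → ℕ → List ℕ → Set where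
  single : ∀ {lo U q} → lo ≤ q → q < U → Ascending lo U 0 (q ∷ [])
  cons   : ∀ {lo U q j ps} → lo ≤ q → Ascending (suc q) U j ps → Ascending lo U (suc j) (q ∷ ps)

Ascending⇒< : ∀ {lo U j ps} → Ascending lo U j ps → lo < U
Ascending⇒< (single lo≤q q<U) = ≤-<-trans lo≤q q<U
Ascending⇒< (cons lo≤q asc)   = ≤-<-trans lo≤q (<-trans (n<1+n _) (Ascending⇒< asc))

Ascending-weaken : ∀ {lo lo′ U j ps} → lo′ ≤ lo → Ascending lo U j ps → Ascending lo′ U j ps
Ascending-weaken lo′≤lo (single lo≤q q<U) = single (≤-trans lo′≤lo lo≤q) q<U
Ascending-weaken lo′≤lo (cons lo≤q asc)   = cons (≤-trans lo′≤lo lo≤q) asc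

record Segment (a : ℕ → Bool) (p m : ℕ) : Set where
  constructor segment
  field
    zero-at : ∀ i → i < m → a (p + i) ≡ false
    one-at  : a (p + m) ≡ true

Segment-head : ∀ {a p m} → Segment a p (suc m) → a p ≡ false
Segment-head {a} {p} (segment zs _) = trans (cong a (sym (+-identityʳ p))) (zs 0 z<s)

Segment-tail : ∀ {a p m} → Segment a p (suc m) → Segment a (suc p) m
Segment-tail {a} {p} {m} (segment zs one) = segment
  (λ i i<m → trans (cong a (sym (+-suc p i))) (zs (suc i) (s≤s i<m)))
  (trans (cong a (sym (+-suc p m))) one)

Segment-update : ∀ {a p m} b → Segment a p (suc m) → Segment (update a p b) (suc p) m
Segment-update {a} {p} {m} b seg = segment
  (λ i i<m → trans (update-≢ a b (m≢1+m+n p ∘ sym)) (Segment.zero-at (Segment-tail seg) i i<m))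
  (trans (update-≢ a b (m≢1+m+n p ∘ sym)) (Segment.one-at (Segment-tail seg)))

setOnes : List ℕ → (ℕ → Bool) → ℕ → Bool
setOnes []       a = a
setOnes (q ∷ ps) a = setOnes ps (update a q true)

setOnes-below : ∀ ps a {y x} → All (y ≤_) ps → x < y → setOnes ps a x ≡ a x
setOnes-below []       a _          x<y = refl
setOnes-below (q ∷ ps) a (y≤q ∷ ys) x<y =
  trans (setOnes-below ps _ ys x<y) (update-≢ a true (<⇒≢ (<-≤-trans x<y y≤q)))

-- The separating machine

module Machine (k : ℕ) where

  -- place j puts j + 1 further ones, in every possible way, into the zero cells between the head
  -- and the next one; back j walks left to the one last written by place j.
  data St : Set where
    markFirst checkFirst checkSecond fillRight clearLeft visit accept reject : St
    place back : ℕ → St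

  R : ℕ
  R = suc k

  Qn : ℕ
  Qn = 8 + (R + R)

  index : St → ℕ
  index markFirst   = 0
  index checkFirst  = 1
  index checkSecond = 2
  index fillRight   = 3
  index clearLeft   = 4
  index visit       = 5
  index accept      = 6
  index reject      = 7
  index (place j)   = 8 + j
  index (back j)    = 8 + (R + j)

  Valid : St → Set
  Valid (place j) = j < R
  Valid (back j)  = j < R
  Valid _         = ⊤

  index<Qn : ∀ s → Valid s → index s < Qn
  index<Qn (place j) j<R = +-monoʳ-< 8 (≤-trans j<R (m≤m+n R R))
  index<Qn (back j)  j<R = +-monoʳ-< 8 (+-monoʳ-< R j<R)
  index<Qn markFirst   _ = s≤s z≤n
  index<Qn checkFirst  _ = s≤s (s≤s z≤n)
  index<Qn checkSecond _ = s≤s (s≤s (s≤s z≤n))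
  index<Qn fillRight   _ = s≤s (s≤s (s≤s (s≤s z≤n)))
  index<Qn clearLeft   _ = s≤s (s≤s (s≤s (s≤s (s≤s z≤n))))
  index<Qn visit       _ = s≤s (s≤s (s≤s (s≤s (s≤s (s≤s z≤n)))))
  index<Qn accept      _ = s≤s (s≤s (s≤s (s≤s (s≤s (s≤s (s≤s z≤n))))))
  index<Qn reject      _ = s≤s (s≤s (s≤s (s≤s (s≤s (s≤s (s≤s (s≤s z≤n)))))))

  -- Invalid states (place j or back j with j > k) never arise; they get the junk code of reject.
  encode : St → Fin Qn
  encode s with index s <? Qn
  ... | yes i<Qn = fromℕ< i<Qn
  ... | no _     = fromℕ< (index<Qn reject tt)

  decodeℕ : ℕ → St
  decodeℕ 0 = markFirst
  decodeℕ 1 = checkFirst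
  decodeℕ 2 = checkSecond
  decodeℕ 3 = fillRight
  decodeℕ 4 = clearLeft
  decodeℕ 5 = visit
  decodeℕ 6 = accept
  decodeℕ 7 = reject
  decodeℕ (suc (suc (suc (suc (suc (suc (suc (suc m)))))))) = if m <ᵇ R then place m else back (m ∸ R)

  decode : Fin Qn → St
  decode q = decodeℕ (toℕ q)

  decodeℕ-index : ∀ s → Valid s → decodeℕ (index s) ≡ s
  decodeℕ-index (place j) j<R with j <ᵇ R | <⇒<ᵇ j<R
  ... | true | _ = refl
  decodeℕ-index (back j) _ with (R + j) <ᵇ R in eq
  ... | true  = contradiction (<ᵇ⇒< (R + j) R (subst T (sym eq) tt)) (m+n≮m R j)
  ... | false = cong back (m+n∸m≡n R j)
  decodeℕ-index markFirst   _ = refl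
  decodeℕ-index checkFirst  _ = refl
  decodeℕ-index checkSecond _ = refl
  decodeℕ-index fillRight   _ = refl
  decodeℕ-index clearLeft   _ = refl
  decodeℕ-index visit       _ = refl
  decodeℕ-index accept      _ = refl
  decodeℕ-index reject      _ = refl

  decode-encode : ∀ s → Valid s → decode (encode s) ≡ s
  decode-encode s v with index s <? Qn
  ... | yes i<Qn = trans (cong decodeℕ (toℕ-fromℕ< i<Qn)) (decodeℕ-index s v)
  ... | no i≮Qn  = contradiction (index<Qn s v) i≮Qn

  isHalt : St → Bool
  isHalt accept = true
  isHalt reject = true
  isHalt _      = false

  isAccept : St → Bool
  isAccept accept = true
  isAccept _      = false

  Running : St → Set
  Running accept = ⊥
  Running reject = ⊥
  Running s      = Valid s

  Running⇒Valid : ∀ {s} → Running s → Valid s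
  Running⇒Valid {markFirst}   r = r
  Running⇒Valid {checkFirst}  r = r
  Running⇒Valid {checkSecond} r = r
  Running⇒Valid {fillRight}   r = r
  Running⇒Valid {clearLeft}   r = r
  Running⇒Valid {visit}       r = r
  Running⇒Valid {place j}     r = r
  Running⇒Valid {back j}      r = r

  Running⇒¬halt : ∀ {s} → Running s → isHalt s ≡ false
  Running⇒¬halt {markFirst}   _ = refl
  Running⇒¬halt {checkFirst}  _ = refl
  Running⇒¬halt {checkSecond} _ = refl
  Running⇒¬halt {fillRight}   _ = refl
  Running⇒¬halt {clearLeft}   _ = refl
  Running⇒¬halt {visit}       _ = refl
  Running⇒¬halt {place j}     _ = refl
  Running⇒¬halt {back j}      _ = refl

  atSentinel : ℕ → St × Bool × Move
  atSentinel j with j ≟ k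
  ... | yes _ = reject , true , stay
  ... | no _  = back (suc j) , true , left

  atSentinel-≢ : ∀ {j} → j ≢ k → atSentinel j ≡ (back (suc j) , true , left)
  atSentinel-≢ {j} j≢k with j ≟ k
  ... | yes j≡k = contradiction j≡k j≢k
  ... | no _    = refl

  atSentinel-≡ : atSentinel k ≡ (reject , true , stay)
  atSentinel-≡ with k ≟ k
  ... | yes _   = refl
  ... | no k≢k  = contradiction refl k≢k

  -- The finite control while the input cells read hold 0: new state, address bit written, head move.
  control : St → Bool → St × Bool × Move
  control markFirst       _     = checkFirst , true , stay
  control checkFirst      false = reject , false , stay
  control checkFirst      true  = checkSecond , true , right
  control checkSecond     false = fillRight , true , right
  control checkSecond     true  = reject , true , stay
  control fillRight       false = fillRight , true , right
  control fillRight       true  = clearLeft , true , left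
  control clearLeft       true  = clearLeft , false , left
  control clearLeft       false = place k , false , stay
  control visit           _     = place 0 , false , right
  control (place j)       true  = atSentinel j
  control (place zero)    false = visit , true , stay
  control (place (suc j)) false = place j , true , right
  control (back j)        false = back j , false , left
  control (back j)        true  = place j , false , right
  control accept          b     = accept , b , stay
  control reject          b     = reject , b , stay

  delta : Bool → Fin Qn → Bool → Fin Qn × (Bool × Move) × (Fin 0 → Fin 1 × Move)
  delta true  q b = encode accept , (b , stay) , λ ()
  delta false q b = encode (proj₁ next) , (proj₁ (proj₂ next) , proj₂ (proj₂ next)) , λ ()
    where next = control (decode q) b

  machine : RATM
  machine = record
    { Q = Qn ; Γ = 0 ; k = 0 ; start = encode markFirst
    ; halting   = λ q → isHalt (decode q)
    ; accepting = λ q → isAccept (decode q)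
    ; δ         = λ q ins b _ → delta (isOne ins) q b }

  enumTime : ℕ → ℕ → ℕ
  enumTime j       zero    = 0
  enumTime zero    (suc m) = 2 + enumTime zero m
  enumTime (suc j) (suc m) = 1 + (enumTime j m + (suc (m + 1) + enumTime (suc j) m))

  initTime : ℕ → ℕ
  initTime l = 2 + (suc l + (1 + (suc l + 1)))

  rejectTime : ℕ → ℕ
  rejectTime l = initTime l + (enumTime k (suc l) + 1)

  timeFactor : ℕ
  timeFactor = 4 * suc k + 2

  3≤timeFactor : 3 ≤ timeFactor
  3≤timeFactor = ≤-trans (m≤m+n 3 3) (+-monoˡ-≤ 2 (*-monoʳ-≤ 4 (s≤s z≤n)))

  enumTime-≤ : ∀ X j m → m ≤ X → enumTime j m ≤ 4 * suc j * (m * X ^ j)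
  enumTime-≤ X j       zero    _     = z≤n
  enumTime-≤ X zero    (suc m) 1+m≤X = begin
    2 + enumTime 0 m       ≤⟨ +-mono-≤ (≤-trans (n≤1+n 2) (n≤1+n 3)) (enumTime-≤ X 0 m (≤-trans (n≤1+n m) 1+m≤X)) ⟩
    4 + 4 * (m * 1)        ≡⟨ sym (*-distribˡ-+ 4 1 (m * 1)) ⟩
    4 * (suc m * 1)        ∎
    where open ≤-Reasoning
  enumTime-≤ X (suc j) (suc m) 1+m≤X = begin
    enumTime (suc j) (suc m)                           ≡⟨ unfold (enumTime j m) m (enumTime (suc j) m) ⟩
    (3 + m) + enumTime j m + enumTime (suc j) m         ≤⟨ +-mono-≤ (+-mono-≤ 3+m≤ inner≤) (enumTime-≤ X (suc j) m m≤X) ⟩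
    4 * Y + 4 * suc j * Y + 4 * suc (suc j) * (m * Y)  ≡⟨ fold (suc j) m Y ⟩
    4 * suc (suc j) * (suc m * Y)                      ∎
    where
      open ≤-Reasoning
      Y = X ^ suc j
      m≤X = ≤-trans (n≤1+n m) 1+m≤X
      1≤X = ≤-trans (s≤s z≤n) 1+m≤X
      unfold : ∀ a m b → suc (a + (suc (m + 1) + b)) ≡ (3 + m) + a + b
      unfold = solve-∀
      fold : ∀ i m Y → 4 * Y + 4 * i * Y + 4 * suc i * (m * Y) ≡ 4 * suc i * (suc m * Y)
      fold = solve-∀
      3+m≤ : 3 + m ≤ 4 * Y
      3+m≤ = begin
        3 + m      ≤⟨ +-monoʳ-≤ 3 m≤X ⟩
        3 + X      ≤⟨ +-monoˡ-≤ X (*-monoʳ-≤ 3 1≤X) ⟩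
        3 * X + X  ≡⟨ +-comm (3 * X) X ⟩
        4 * X      ≤⟨ *-monoʳ-≤ 4 (≤^suc j 1≤X) ⟩
        4 * Y      ∎
      inner≤ : enumTime j m ≤ 4 * suc j * Y
      inner≤ = ≤-trans (enumTime-≤ X j m m≤X) (*-monoʳ-≤ (4 * suc j) (*-monoˡ-≤ (X ^ j) m≤X))

  rejectTime-≤ : ∀ l → rejectTime l ≤ timeFactor * suc (suc l) ^ suc k + timeFactor
  rejectTime-≤ l = begin
    rejectTime l                              ≡⟨ unfold l (enumTime k (suc l)) ⟩
    enumTime k (suc l) + (2 * X + 3)          ≤⟨ +-mono-≤ enum≤ (+-mono-≤ (*-monoʳ-≤ 2 (≤^suc k (s≤s z≤n))) 3≤timeFactor) ⟩
    4 * suc k * P + (2 * P + timeFactor)      ≡⟨ fold k P ⟩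
    timeFactor * P + timeFactor               ∎
    where
      open ≤-Reasoning
      X = suc (suc l)
      P = X ^ suc k
      unfold : ∀ l e → 2 + (suc l + (1 + (suc l + 1))) + (e + 1) ≡ e + (2 * suc (suc l) + 3)
      unfold = solve-∀
      fold : ∀ k P → 4 * suc k * P + (2 * P + (4 * suc k + 2)) ≡ (4 * suc k + 2) * P + (4 * suc k + 2)
      fold = solve-∀
      enum≤ : enumTime k (suc l) ≤ 4 * suc k * P
      enum≤ = ≤-trans (enumTime-≤ X k (suc l) (n≤1+n _)) (*-monoʳ-≤ (4 * suc k) (*-monoˡ-≤ (X ^ k) (n≤1+n (suc l))))

  open Runs machine
  open RATM machine using (halting)
  open Config

  record Snapshot : Set where
    constructor ⟨_,_,_⟩
    field
      st : St
      hd : ℕ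
      tp : ℕ → Bool

  record Describes (x : Snapshot) (c : Config machine) : Set where
    constructor describes
    field
      state≡ : state c ≡ encode (Snapshot.st x)
      ahead≡ : ahead c ≡ Snapshot.hd x
      addr≗  : addr c ≗ Snapshot.tp x

  describes-cong : ∀ {s h h′ a a′ c} → h ≡ h′ → a ≗ a′ → Describes ⟨ s , h , a ⟩ c → Describes ⟨ s , h′ , a′ ⟩ c
  describes-cong h≡h′ a≗a′ (describes st≡ ah≡ ad≗) = describes st≡ (trans ah≡ h≡h′) (λ i → trans (ad≗ i) (a≗a′ i))

  initial : Snapshot
  initial = ⟨ markFirst , 0 , (λ _ → false) ⟩

  initial-describes : Describes initial (initConfig machine)
  initial-describes = describes refl refl (λ _ → refl)

  -- On the all-zero input every read gives 0, so the machine just follows `control`.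
  module OnZeros (n : ℕ) where

    L : ℕ
    L = addrLength (zeros n)

    infix 4 _⟶[_]_
    record _⟶[_]_ (x : Snapshot) (t : ℕ) (y : Snapshot) : Set where
      constructor reaches
      field follow : ∀ {c} → Describes x c → Describes y (stepN (zeros n) t c)
    open _⟶[_]_ public

    ⟶-refl : ∀ {x} → x ⟶[ 0 ] x
    ⟶-refl = reaches λ d → d

    infixr 5 _⟫_
    _⟫_ : ∀ {x y z s t} → x ⟶[ s ] y → y ⟶[ t ] z → x ⟶[ s + t ] z
    _⟫_ {s = s} {t} p q = reaches λ {c} d → subst (Describes _) (sym (stepN-+ (zeros n) s t c)) (follow q (follow p d))

    ⟶-cong : ∀ {x s h h′ a a′ t} → h ≡ h′ → a ≗ a′ → x ⟶[ t ] ⟨ s , h , a ⟩ → x ⟶[ t ] ⟨ s , h′ , a′ ⟩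
    ⟶-cong h≡h′ a≗a′ p = reaches λ d → describes-cong h≡h′ a≗a′ (follow p d)

    module _ {s h a c} (run : Running s) (d : Describes ⟨ s , h , a ⟩ c) where
      open Describes d

      private
        decode≡ : decode (state c) ≡ s
        decode≡ = trans (cong decode state≡) (decode-encode s (Running⇒Valid run))

        running : isHalt (decode (state c)) ≡ false
        running = trans (cong isHalt decode≡) (Running⇒¬halt run)

        transition≡ : transition (zeros n) c ≡ delta false (state c) (a h)
        transition≡ = cong₂ (λ b → delta b (state c)) (isOne-zeros n _) (trans (cong (addr c) ahead≡) (addr≗ h))

        control≡ : control (decode (state c)) (a h) ≡ control s (a h)
        control≡ = cong (λ s′ → control s′ (a h)) decode≡

      step-state≡ : state (step machine (zeros n) c) ≡ encode (proj₁ (control s (a h)))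
      step-state≡ = trans (step-state (zeros n) c running)
                          (trans (cong proj₁ transition≡) (cong (encode ∘ proj₁) control≡))

      step-ahead≡ : ahead (step machine (zeros n) c) ≡ moveBounded L (proj₂ (proj₂ (control s (a h)))) h
      step-ahead≡ = trans (step-ahead (zeros n) c running)
        (trans (cong₂ (λ x p → moveBounded L (proj₂ (proj₁ (proj₂ x))) p) transition≡ ahead≡)
               (cong (λ x → moveBounded L (proj₂ (proj₂ x)) h) control≡))

      step-addr≗ : h < L → addr (step machine (zeros n) c) ≗ update a h (proj₁ (proj₂ (control s (a h))))
      step-addr≗ h<L i = begin
        addr (step machine (zeros n) c) i
          ≡⟨ cong (λ t → t i) (step-addr-< (zeros n) c running (subst (_< L) (sym ahead≡) h<L)) ⟩
        update (addr c) (ahead c) (proj₁ (proj₁ (proj₂ (transition (zeros n) c)))) i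
          ≡⟨ cong₂ (λ p x → update (addr c) p (proj₁ (proj₁ (proj₂ x))) i) ahead≡ transition≡ ⟩
        update (addr c) h (proj₁ (proj₂ (control (decode (state c)) (a h)))) i
          ≡⟨ cong (λ x → update (addr c) h (proj₁ (proj₂ x)) i) control≡ ⟩
        update (addr c) h (proj₁ (proj₂ (control s (a h)))) i
          ≡⟨ update-cong h _ addr≗ i ⟩
        update a h (proj₁ (proj₂ (control s (a h)))) i ∎
        where open ≡-Reasoning

      step-addr≗-≮ : ¬ h < L → addr (step machine (zeros n) c) ≗ a
      step-addr≗-≮ h≮L i =
        trans (cong (λ t → t i) (step-addr-≮ (zeros n) c running (h≮L ∘ subst (_< L) ahead≡))) (addr≗ i)

    ⟶-step : ∀ {s h a s′ b mv h′} → Running s → h < L → control s (a h) ≡ (s′ , b , mv) →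
             moveBounded L mv h ≡ h′ → ⟨ s , h , a ⟩ ⟶[ 1 ] ⟨ s′ , h′ , update a h b ⟩
    ⟶-step {a = a} run h<L ctl mv = reaches λ d → describes
      (trans (step-state≡ run d) (cong (encode ∘ proj₁) ctl))
      (trans (step-ahead≡ run d) (trans (cong (λ x → moveBounded L (proj₂ (proj₂ x)) _) ctl) mv))
      (λ i → trans (step-addr≗ run d h<L i) (cong (λ x → update a _ (proj₁ (proj₂ x)) i) ctl))

    ⟶-step-≮ : ∀ {s h a s′ b mv} → Running s → ¬ h < L → control s (a h) ≡ (s′ , b , mv) →
               ⟨ s , h , a ⟩ ⟶[ 1 ] ⟨ s′ , moveBounded L mv h , a ⟩
    ⟶-step-≮ run h≮L ctl = reaches λ d → describes
      (trans (step-state≡ run d) (cong (encode ∘ proj₁) ctl))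
      (trans (step-ahead≡ run d) (cong (λ x → moveBounded L (proj₂ (proj₂ x)) _) ctl))
      (step-addr≗-≮ run d h≮L)

    VisitsWithin : ℕ → Snapshot → (ℕ → Bool) → Set
    VisitsWithin t x a = Σ ℕ λ s → s < t × Σ ℕ λ h → x ⟶[ s ] ⟨ visit , h , a ⟩

    visited : ∀ {x s h a} → x ⟶[ s ] ⟨ visit , h , a ⟩ → VisitsWithin (suc s) x a
    visited {s = s} {h} p = s , n<1+n s , h , p

    visits-before : ∀ {x s t a} → VisitsWithin s x a → VisitsWithin (s + t) x a
    visits-before (u , u<s , h , p) = u , <-≤-trans u<s (m≤m+n _ _) , h , p

    visits-after : ∀ {x y s t a} → x ⟶[ s ] y → VisitsWithin t y a → VisitsWithin (s + t) x a
    visits-after {s = s} p (u , u<t , h , q) = s + u , +-monoʳ-< s u<t , h , p ⟫ q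

    walkBack : ∀ {j a} → j < R → ∀ m p → p + m < L → (∀ t → t < m → a (p + suc t) ≡ false) →
               ⟨ back j , p + m , a ⟩ ⟶[ m ] ⟨ back j , p , a ⟩
    walkBack j<R zero    p _   _  = ⟶-cong (+-identityʳ p) (λ _ → refl) ⟶-refl
    walkBack {j} {a} j<R (suc m) p end zs =
      stepLeft ⟫ walkBack j<R m p (<-trans (n<1+n _) end′) (λ t t<m → zs t (<-trans t<m (n<1+n m)))
      where
        end′ : suc (p + m) < L
        end′ = subst (_< L) (+-suc p m) end
        stepLeft : ⟨ back j , p + suc m , a ⟩ ⟶[ 1 ] ⟨ back j , p + m , a ⟩
        stepLeft = ⟶-cong refl (update-id a _ (zs m (n<1+n m)))
          (⟶-step j<R end (cong (control (back j)) (zs m (n<1+n m)))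
                  (trans (cong (moveBounded L left) (+-suc p m)) (moveBounded-< left (suc (p + m)) (<-trans (n<1+n _) end′))))

    -- Once place j has run through the rest of the segment, the one written at p by place (suc j)
    -- is cleared and place (suc j) resumes one cell further right.
    backtrack : ∀ {j a} m p → suc j ≤ k → p + suc m < L → Segment a p (suc m) →
                ⟨ place j , suc p + m , update a p true ⟩ ⟶[ suc (m + 1) ] ⟨ place (suc j) , suc p , a ⟩
    backtrack {j} {a} m p 1+j≤k end seg = turn ⟫ walk ⟫ resume
      where
        end′ : suc p + m < L
        end′ = subst (_< L) (+-suc p m) end
        1+p<L : suc p < L
        1+p<L = ≤-<-trans (s≤s (m≤m+n p m)) end′
        a₁ = update a p true
        seg₁ : Segment a₁ (suc p) m
        seg₁ = Segment-update true seg
        turn : ⟨ place j , suc p + m , a₁ ⟩ ⟶[ 1 ] ⟨ back (suc j) , p + m , a₁ ⟩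
        turn = ⟶-cong refl (update-id a₁ _ (Segment.one-at seg₁))
          (⟶-step (<-trans (n<1+n j) (s≤s 1+j≤k)) end′
                  (trans (cong (control (place j)) (Segment.one-at seg₁)) (atSentinel-≢ (<⇒≢ 1+j≤k)))
                  (moveBounded-< left (suc p + m) (<-trans (n<1+n _) end′)))
        walk : ⟨ back (suc j) , p + m , a₁ ⟩ ⟶[ m ] ⟨ back (suc j) , p , a₁ ⟩
        walk = walkBack (s≤s 1+j≤k) m p (<-trans (n<1+n _) end′)
          (λ t t<m → trans (cong a₁ (+-suc p t)) (Segment.zero-at seg₁ t t<m))
        resume : ⟨ back (suc j) , p , a₁ ⟩ ⟶[ 1 ] ⟨ place (suc j) , suc p , a ⟩
        resume = ⟶-cong refl (λ i → trans (update-update a p true false i) (update-id a p (Segment-head seg) i))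
          (⟶-step (s≤s 1+j≤k) (<-trans (n<1+n p) 1+p<L) (cong (control (back (suc j))) (update-≡ a p true))
                  (moveBounded-< right p 1+p<L))

    record Enumerates (j m p : ℕ) (a : ℕ → Bool) : Set where
      field
        ends   : ⟨ place j , p , a ⟩ ⟶[ enumTime j m ] ⟨ place j , p + m , a ⟩
        visits : ∀ {ps} → Ascending p (p + m) j ps → VisitsWithin (enumTime j m) ⟨ place j , p , a ⟩ (setOnes ps a)

    enumerate : ∀ j m p a → j ≤ k → p + m < L → Segment a p m → Enumerates j m p a
    enumerate j zero p a _ _ _ = record
      { ends   = ⟶-cong (sym (+-identityʳ p)) (λ _ → refl) ⟶-refl
      ; visits = λ asc → ⊥-elim (<-irrefl (sym (+-identityʳ p)) (Ascending⇒< asc)) }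
    enumerate zero (suc m) p a j≤k end seg = record { ends = ends ; visits = visits }
      where
        end′ : suc p + m < L
        end′ = subst (_< L) (+-suc p m) end
        p<L : p < L
        p<L = <-trans (n<1+n p) (≤-<-trans (s≤s (m≤m+n p m)) end′)
        module Rest = Enumerates (enumerate zero m (suc p) a j≤k end′ (Segment-tail seg))
        toVisit : ⟨ place 0 , p , a ⟩ ⟶[ 1 ] ⟨ visit , p , update a p true ⟩
        toVisit = ⟶-step (s≤s z≤n) p<L (cong (control (place 0)) (Segment-head seg)) (moveBounded-< stay p p<L)
        fromVisit : ⟨ visit , p , update a p true ⟩ ⟶[ 1 ] ⟨ place 0 , suc p , a ⟩
        fromVisit = ⟶-cong refl (λ i → trans (update-update a p true false i) (update-id a p (Segment-head seg) i))
          (⟶-step tt p<L refl (moveBounded-< right p (≤-<-trans (s≤s (m≤m+n p m)) end′)))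
        ends : ⟨ place 0 , p , a ⟩ ⟶[ enumTime 0 (suc m) ] ⟨ place 0 , p + suc m , a ⟩
        ends = ⟶-cong (sym (+-suc p m)) (λ _ → refl) (toVisit ⟫ fromVisit ⟫ Rest.ends)
        visits : ∀ {ps} → Ascending p (p + suc m) 0 ps → VisitsWithin (enumTime 0 (suc m)) ⟨ place 0 , p , a ⟩ (setOnes ps a)
        visits (single {q = q} p≤q q<U) with m≤n⇒m<n∨m≡n p≤q
        ... | inj₂ refl = visits-before (visited toVisit)
        ... | inj₁ p<q  = visits-after (toVisit ⟫ fromVisit) (Rest.visits (single p<q (subst (q <_) (+-suc p m) q<U)))
    enumerate (suc j) (suc m) p a 1+j≤k end seg = record { ends = ends ; visits = visits }
      where
        end′ : suc p + m < L
        end′ = subst (_< L) (+-suc p m) end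
        1+p<L : suc p < L
        1+p<L = ≤-<-trans (s≤s (m≤m+n p m)) end′
        module Inner = Enumerates (enumerate j m (suc p) (update a p true) (≤-trans (n≤1+n j) 1+j≤k) end′ (Segment-update true seg))
        module Rest  = Enumerates (enumerate (suc j) m (suc p) a 1+j≤k end′ (Segment-tail seg))
        first : ⟨ place (suc j) , p , a ⟩ ⟶[ 1 ] ⟨ place j , suc p , update a p true ⟩
        first = ⟶-step (s≤s 1+j≤k) (<-trans (n<1+n p) 1+p<L) (cong (control (place (suc j))) (Segment-head seg))
                       (moveBounded-< right p 1+p<L)
        ends : ⟨ place (suc j) , p , a ⟩ ⟶[ enumTime (suc j) (suc m) ] ⟨ place (suc j) , p + suc m , a ⟩
        ends = ⟶-cong (sym (+-suc p m)) (λ _ → refl) (first ⟫ Inner.ends ⟫ backtrack m p 1+j≤k end seg ⟫ Rest.ends)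
        visits : ∀ {ps} → Ascending p (p + suc m) (suc j) ps →
                 VisitsWithin (enumTime (suc j) (suc m)) ⟨ place (suc j) , p , a ⟩ (setOnes ps a)
        visits (cons {q = q} {ps = ps} p≤q asc) with m≤n⇒m<n∨m≡n p≤q
        ... | inj₂ refl = visits-after first (visits-before (Inner.visits (subst (λ U → Ascending (suc p) U j ps) (+-suc p m) asc)))
        ... | inj₁ p<q  = visits-after first (visits-after Inner.ends (visits-after (backtrack m p 1+j≤k end seg)
                            (Rest.visits (cons p<q (subst (λ U → Ascending (suc q) U j ps) (+-suc p m) asc)))))

    fill : ∀ d h {s a} → Running s → control s false ≡ (fillRight , true , right) → suc (h + d) ≡ L →
           (∀ i → i < h → a i ≡ true) → (∀ i → h ≤ i → a i ≡ false) →
           Σ (ℕ → Bool) λ a′ → (∀ i → i < L → a′ i ≡ true) × ⟨ s , h , a ⟩ ⟶[ suc d ] ⟨ fillRight , h + d , a′ ⟩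
    fill zero h {s} {a} run ctl end ones zs =
      update a h true , ones′ ,
      ⟶-cong (sym (+-identityʳ h)) (λ _ → refl)
        (⟶-step run h<L (trans (cong (control s) (zs h ≤-refl)) ctl) (moveBounded-≮ right h (<-irrefl h+1≡L)))
      where
        h+1≡L : suc h ≡ L
        h+1≡L = trans (cong suc (sym (+-identityʳ h))) end
        h<L : h < L
        h<L = subst (h <_) h+1≡L (n<1+n h)
        ones′ : ∀ i → i < L → update a h true i ≡ true
        ones′ i i<L = update-elim (_≡ true) a h true refl
          (λ i≢h → ones i (≤∧≢⇒< (≤-pred (subst (suc i ≤_) (sym h+1≡L) i<L)) i≢h))
    fill (suc d) h {s} {a} run ctl end ones zs =
      let (a′ , ones′ , rest) = fill d (suc h) {fillRight} tt refl (trans (cong suc (sym (+-suc h d))) end) ones₁ zs₁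
      in a′ , ones′ , first ⟫ ⟶-cong (sym (+-suc h d)) (λ _ → refl) rest
      where
        1+h<L : suc h < L
        1+h<L = subst (suc h <_) end (s≤s (subst (suc h ≤_) (sym (+-suc h d)) (s≤s (m≤m+n h d))))
        first : ⟨ s , h , a ⟩ ⟶[ 1 ] ⟨ fillRight , suc h , update a h true ⟩
        first = ⟶-step run (<-trans (n<1+n h) 1+h<L) (trans (cong (control s) (zs h ≤-refl)) ctl) (moveBounded-< right h 1+h<L)
        ones₁ : ∀ i → i < suc h → update a h true i ≡ true
        ones₁ i i<1+h = update-elim (_≡ true) a h true refl (λ i≢h → ones i (≤∧≢⇒< (≤-pred i<1+h) i≢h))
        zs₁ : ∀ i → suc h ≤ i → update a h true i ≡ false
        zs₁ i 1+h≤i = trans (update-≢ a true (≢-sym (<⇒≢ 1+h≤i))) (zs i (<⇒≤ 1+h≤i))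

    run-describes : ∀ {t y} → initial ⟶[ t ] y → Describes y (run machine (zeros n) t)
    run-describes {t} p = subst (Describes _) (sym (run≡stepN (zeros n) t)) (follow p initial-describes)

    RejectsWithin : ℕ → Set
    RejectsWithin t = Σ ℕ λ s → s ≤ t × Σ ℕ λ h → Σ (ℕ → Bool) λ a → initial ⟶[ s ] ⟨ reject , h , a ⟩

    -- An empty address tape: the written one is lost and read back as 0.
    rejects-L≡0 : L ≡ 0 → initial ⟶[ 2 ] ⟨ reject , 0 , (λ _ → false) ⟩
    rejects-L≡0 L≡0 = mark ⟫ check
      where
        0≮L : ¬ 0 < L
        0≮L 0<L = <-irrefl refl (subst (0 <_) L≡0 0<L)
        mark : initial ⟶[ 1 ] ⟨ checkFirst , 0 , (λ _ → false) ⟩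
        mark = ⟶-cong (moveBounded-≮ stay 0 0≮L) (λ _ → refl) (⟶-step-≮ tt 0≮L refl)
        check : ⟨ checkFirst , 0 , (λ _ → false) ⟩ ⟶[ 1 ] ⟨ reject , 0 , (λ _ → false) ⟩
        check = ⟶-cong (moveBounded-≮ stay 0 0≮L) (λ _ → refl) (⟶-step-≮ tt 0≮L refl)

    -- A one-cell address tape: the head cannot move right and reads back the one it wrote.
    rejects-L≡1 : L ≡ 1 → initial ⟶[ 3 ] ⟨ reject , 0 , update (λ _ → false) 0 true ⟩
    rejects-L≡1 L≡1 = mark ⟫ check ⟫ checkAgain
      where
        0<L : 0 < L
        0<L = subst (0 <_) (sym L≡1) z<s
        a₁ = update (λ _ → false) 0 true
        mark : initial ⟶[ 1 ] ⟨ checkFirst , 0 , a₁ ⟩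
        mark = ⟶-step tt 0<L refl (moveBounded-< stay 0 0<L)
        check : ⟨ checkFirst , 0 , a₁ ⟩ ⟶[ 1 ] ⟨ checkSecond , 0 , a₁ ⟩
        check = ⟶-cong refl (update-id a₁ 0 (update-≡ (λ _ → false) 0 true))
          (⟶-step tt 0<L (cong (control checkFirst) (update-≡ (λ _ → false) 0 true)) (moveBounded-≮ right 0 (<-irrefl (sym L≡1))))
        checkAgain : ⟨ checkSecond , 0 , a₁ ⟩ ⟶[ 1 ] ⟨ reject , 0 , a₁ ⟩
        checkAgain = ⟶-cong refl (update-id a₁ 0 (update-≡ (λ _ → false) 0 true))
          (⟶-step tt 0<L (cong (control checkSecond) (update-≡ (λ _ → false) 0 true)) (moveBounded-< stay 0 0<L))

    module LongTape (l : ℕ) (L≡ : L ≡ suc (suc l)) where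

      <L : ∀ {i} → i < suc (suc l) → i < L
      <L {i} = subst (i <_) (sym L≡)

      clear : ∀ d {a} → d < suc l → (∀ i → i ≤ d → a i ≡ true) → a (suc l) ≡ true →
              (∀ i → d < i → i < suc l → a i ≡ false) →
              Σ (ℕ → Bool) λ a′ → Segment a′ 0 (suc l) × ⟨ clearLeft , d , a ⟩ ⟶[ suc d ] ⟨ clearLeft , 0 , a′ ⟩
      clear zero {a} _ ones top zs =
        update a 0 false ,
        segment zs₀ (trans (update-≢ a {0} false (λ ())) top) ,
        ⟶-step tt (<L z<s) (cong (control clearLeft) (ones 0 z≤n)) (moveBounded-< left 0 (<L z<s))
        where
          zs₀ : ∀ i → i < suc l → update a 0 false i ≡ false
          zs₀ zero    _     = update-≡ a 0 false
          zs₀ (suc i) i<1+l = trans (update-≢ a {0} false (λ ())) (zs (suc i) z<s i<1+l)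
      clear (suc d) {a} d<1+l ones top zs =
        proj₁ rest , proj₁ (proj₂ rest) , stepLeft ⟫ proj₂ (proj₂ rest)
        where
          1+d<L : suc d < L
          1+d<L = <L (<-trans d<1+l (n<1+n _))
          stepLeft : ⟨ clearLeft , suc d , a ⟩ ⟶[ 1 ] ⟨ clearLeft , d , update a (suc d) false ⟩
          stepLeft = ⟶-step tt 1+d<L (cong (control clearLeft) (ones (suc d) ≤-refl))
                            (moveBounded-< left (suc d) (<-trans (n<1+n d) 1+d<L))
          rest = clear d {update a (suc d) false} (<-trans (n<1+n d) d<1+l)
            (λ i i≤d → trans (update-≢ a false (<⇒≢ (s≤s i≤d))) (ones i (≤-trans i≤d (n≤1+n d))))
            (trans (update-≢ a false (≢-sym (<⇒≢ d<1+l))) top)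
            (λ i d<i i<1+l → update-elim (_≡ false) a (suc d) false refl
                                (λ i≢1+d → zs i (≤∧≢⇒< d<i (≢-sym i≢1+d)) i<1+l))

      initialise : Σ (ℕ → Bool) λ a* → Segment a* 0 (suc l) × initial ⟶[ initTime l ] ⟨ place k , 0 , a* ⟩
      initialise = a* , seg* , mark ⟫ check ⟫ proj₂ filled ⟫ turn ⟫ proj₂ (proj₂ cleared) ⟫ start
        where
          0<L : 0 < L
          0<L = <L z<s
          a₁ = update (λ _ → false) 0 true
          mark : initial ⟶[ 1 ] ⟨ checkFirst , 0 , a₁ ⟩
          mark = ⟶-step tt 0<L refl (moveBounded-< stay 0 0<L)
          check : ⟨ checkFirst , 0 , a₁ ⟩ ⟶[ 1 ] ⟨ checkSecond , 1 , update a₁ 0 true ⟩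
          check = ⟶-step tt 0<L (cong (control checkFirst) (update-≡ (λ _ → false) 0 true)) (moveBounded-< right 0 (<L (s≤s z<s)))
          fillResult = fill l 1 {checkSecond} {update a₁ 0 true} tt refl (sym L≡)
            (λ { zero _ → update-≡ a₁ 0 true ; (suc i) (s≤s ()) })
            (λ { zero () ; (suc i) _ → trans (update-≢ a₁ {0} true {suc i} (λ ()))
                                             (update-≢ (λ _ → false) {0} true {suc i} (λ ())) })
          a₃ = proj₁ fillResult
          filled : (∀ i → i < L → a₃ i ≡ true) × ⟨ checkSecond , 1 , update a₁ 0 true ⟩ ⟶[ suc l ] ⟨ fillRight , suc l , a₃ ⟩
          filled = proj₂ fillResult
          a₄ = update a₃ (suc l) true
          turn : ⟨ fillRight , suc l , a₃ ⟩ ⟶[ 1 ] ⟨ clearLeft , l , a₄ ⟩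
          turn = ⟶-step tt (<L ≤-refl) (cong (control fillRight) (proj₁ filled (suc l) (<L ≤-refl)))
                        (moveBounded-< left (suc l) (<L (<-trans (n<1+n l) ≤-refl)))
          cleared = clear l {a₄} ≤-refl
            (λ i i≤l → trans (update-≢ a₃ true (<⇒≢ (s≤s i≤l)))
                             (proj₁ filled i (<L (s≤s (≤-trans i≤l (n≤1+n l))))))
            (update-≡ a₃ (suc l) true)
            (λ i l<i i<1+l → contradiction (≤-trans l<i (≤-pred i<1+l)) (1+n≰n))
          a* = proj₁ cleared
          seg* : Segment a* 0 (suc l)
          seg* = proj₁ (proj₂ cleared)
          start : ⟨ clearLeft , 0 , a* ⟩ ⟶[ 1 ] ⟨ place k , 0 , a* ⟩
          start = ⟶-cong refl (update-id a* 0 (Segment.zero-at seg* 0 z<s))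
            (⟶-step tt 0<L (cong (control clearLeft) (Segment.zero-at seg* 0 z<s)) (moveBounded-< stay 0 0<L))

      a* : ℕ → Bool
      a* = proj₁ initialise

      seg* : Segment a* 0 (suc l)
      seg* = proj₁ (proj₂ initialise)

      private
        module Main = Enumerates (enumerate k (suc l) 0 a* ≤-refl (<L ≤-refl) seg*)

      rejects : initial ⟶[ rejectTime l ] ⟨ reject , suc l , a* ⟩
      rejects = proj₂ (proj₂ initialise) ⟫ Main.ends ⟫ finish
        where
          finish : ⟨ place k , suc l , a* ⟩ ⟶[ 1 ] ⟨ reject , suc l , a* ⟩
          finish = ⟶-cong refl (update-id a* (suc l) (Segment.one-at seg*))
            (⟶-step (n<1+n k) (<L ≤-refl) (trans (cong (control (place k)) (Segment.one-at seg*)) atSentinel-≡)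
                    (moveBounded-< stay (suc l) (<L ≤-refl)))

      visitsAll : ∀ {ps} → Ascending 0 (suc l) k ps → VisitsWithin (rejectTime l) initial (setOnes ps a*)
      visitsAll asc = visits-after (proj₂ (proj₂ initialise)) (visits-before (Main.visits asc))

      candidate : List ℕ → ℕ
      candidate ps = addrVal (setOnes ps a*) (suc (suc l))

    rejectsWithin : RejectsWithin (timeFactor * L ^ suc k + timeFactor)
    rejectsWithin = byLength L refl
      where
        B = timeFactor * L ^ suc k + timeFactor
        3≤B : 3 ≤ B
        3≤B = ≤-trans 3≤timeFactor (m≤n+m timeFactor _)
        byLength : ∀ m → L ≡ m → RejectsWithin B
        byLength zero          L≡0 = 2 , ≤-trans (n≤1+n 2) 3≤B , 0 , _ , rejects-L≡0 L≡0
        byLength (suc zero)    L≡1 = 3 , 3≤B , 0 , _ , rejects-L≡1 L≡1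
        byLength (suc (suc l)) L≡  =
          rejectTime l , subst (λ x → rejectTime l ≤ timeFactor * x ^ suc k + timeFactor) (sym L≡) (rejectTime-≤ l) ,
          suc l , LongTape.a* l L≡ , LongTape.rejects l L≡

  bound : ℕ → ℕ
  bound n = timeFactor * logPow (suc k) n + timeFactor

  language : Language
  language w = isAccept (decode (state (run machine w (bound (length w)))))

  addrLength-zeros : ∀ n → addrLength (zeros n) ≡ ⌈log₂ n ⌉
  addrLength-zeros n = cong ⌈log₂_⌉ (length-replicate n)

  halting-encode : ∀ s → Valid s → halting (encode s) ≡ isHalt s
  halting-encode s v = cong isHalt (decode-encode s v)

  zeros-rejected : ∀ n {t} → bound n ≤ t → state (run machine (zeros n) t) ≡ encode reject
  zeros-rejected n {t} B≤t = trans (cong state (run-halted (zeros n) halted (≤-trans s≤B B≤t))) rejected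
    where
      open OnZeros n using (rejectsWithin; run-describes)
      s = proj₁ rejectsWithin
      s≤B : s ≤ bound n
      s≤B = subst (λ x → s ≤ timeFactor * x ^ suc k + timeFactor) (addrLength-zeros n) (proj₁ (proj₂ rejectsWithin))
      rejected : state (run machine (zeros n) s) ≡ encode reject
      rejected = Describes.state≡ (run-describes (proj₂ (proj₂ (proj₂ (proj₂ rejectsWithin)))))
      halted : halting (state (run machine (zeros n) s)) ≡ true
      halted = trans (cong (halting) rejected) (halting-encode reject tt)

  step-reads-one : ∀ w c → halting (state c) ≡ false → isOne (readAt w c) ≡ true →
                   state (step machine w c) ≡ encode accept
  step-reads-one w c running one =
    trans (step-state w c running) (cong (λ b → proj₁ (delta b (state c) (addr c (ahead c)))) one)

  run-zeros-or-accept : ∀ w t → run machine w t ≡ run machine (zeros (length w)) t ⊎ state (run machine w t) ≡ encode accept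
  run-zeros-or-accept w zero = inj₁ refl
  run-zeros-or-accept w (suc t) with run-zeros-or-accept w t
  ... | inj₂ acc = inj₂ (trans (cong state (step-halted w _ (trans (cong (halting) acc) (halting-encode accept tt)))) acc)
  ... | inj₁ eq  with readInput-zeros-or-one w (addrVal (addr (run machine w t)) (addrLength w))
  ...   | inj₁ same = inj₁ (trans (step-input-cong c (sym (length-replicate (length w))) same′) (cong (step machine z) eq))
    where
      z = zeros (length w)
      c = run machine w t
      same′ : readAt w c ≡ readAt z c
      same′ = trans same (cong (λ L → readInput z (addrVal (addr c) L)) (sym (addrLength-zeros (length w))))
  ...   | inj₂ one  = byHalting (halting (state c)) refl
    where
      z = zeros (length w)
      c = run machine w t
      byHalting : ∀ b → halting (state c) ≡ b →
                  step machine w c ≡ step machine z (run machine z t) ⊎ state (step machine w c) ≡ encode accept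
      byHalting true  h =
        inj₁ (trans (step-halted w c h) (trans eq (sym (step-halted z _ (trans (cong (halting ∘ state) (sym eq)) h)))))
      byHalting false h = inj₂ (step-reads-one w c h (cong isOne one))

  halts-at-bound : ∀ w → halting (state (run machine w (bound (length w)))) ≡ true
  halts-at-bound w with run-zeros-or-accept w (bound (length w))
  ... | inj₁ eq  = trans (cong (halting ∘ state) eq)
                         (trans (cong (halting) (zeros-rejected (length w) ≤-refl)) (halting-encode reject tt))
  ... | inj₂ acc = trans (cong (halting) acc) (halting-encode accept tt)

  language∈DTIME : DTIME (logPow (suc k)) language
  language∈DTIME = machine , timeFactor , λ w → bound (length w) , ≤-refl , halts-at-bound w , refl

  language-zeros : ∀ n → language (zeros n) ≡ false
  language-zeros n =
    trans (cong (isAccept ∘ decode) (zeros-rejected n (≤-reflexive (cong bound (sym (length-replicate n))))))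
          (cong isAccept (decode-encode reject tt))

  language-reads-one : ∀ w t → t < bound (length w) →
    halting (state (run machine (zeros (length w)) t)) ≡ false →
    isOne (readAt w (run machine (zeros (length w)) t)) ≡ true → language w ≡ true
  language-reads-one w t t<B running one =
    trans (cong (isAccept ∘ decode) (trans (cong state (run-halted w halted (proj₁ (proj₂ accepted)))) (proj₂ (proj₂ accepted))))
          (cong isAccept (decode-encode accept tt))
    where
      accepted : Σ ℕ λ t′ → t′ ≤ bound (length w) × state (run machine w t′) ≡ encode accept
      accepted with run-zeros-or-accept w t
      ... | inj₁ eq  = suc t , t<B , step-reads-one w (run machine w t) (trans (cong (halting ∘ state) eq) running)
                                                       (trans (cong (isOne ∘ readAt w) eq) one)
      ... | inj₂ acc = t , <⇒≤ t<B , acc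
      halted : halting (state (run machine w (proj₁ accepted))) ≡ true
      halted = trans (cong (halting) (proj₂ (proj₂ accepted))) (halting-encode accept tt)

  language-candidate : ∀ n l (L≡ : addrLength (zeros n) ≡ suc (suc l)) {ps} → Ascending 0 (suc l) k ps →
    OnZeros.LongTape.candidate n l L≡ ps < n → language (setOne (zeros n) (OnZeros.LongTape.candidate n l L≡ ps)) ≡ true
  language-candidate n l L≡ {ps} asc d<n = language-reads-one w₁ s₀ s₀<bound running reads-one
    where
      open OnZeros n using (run-describes)
      open OnZeros.LongTape n l L≡ using (a*; visitsAll; candidate)
      w₁ = setOne (zeros n) (candidate ps)
      len : length w₁ ≡ n
      len = trans (length-setOne (zeros n) _) (length-replicate n)
      L₁≡ : addrLength w₁ ≡ suc (suc l)
      L₁≡ = trans (cong ⌈log₂_⌉ (trans len (sym (length-replicate n)))) L≡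
      visited₀ = visitsAll asc
      s₀ = proj₁ visited₀
      h₀ = proj₁ (proj₂ (proj₂ visited₀))
      c₀ = run machine (zeros (length w₁)) s₀
      at : Describes ⟨ visit , h₀ , setOnes ps a* ⟩ c₀
      at = subst (λ w → Describes ⟨ visit , h₀ , setOnes ps a* ⟩ (run machine w s₀))
                 (cong zeros (sym len)) (run-describes (proj₂ (proj₂ (proj₂ visited₀))))
      s₀<bound : s₀ < bound (length w₁)
      s₀<bound = <-≤-trans (proj₁ (proj₂ visited₀))
        (subst (λ x → rejectTime l ≤ timeFactor * x ^ suc k + timeFactor) (sym L₁≡) (rejectTime-≤ l))
      running : halting (state c₀) ≡ false
      running = trans (cong halting (Describes.state≡ at)) (halting-encode visit tt)
      reads-one : isOne (readAt w₁ c₀) ≡ true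
      reads-one = cong isOne (trans
        (cong (readInput w₁) (trans (cong (addrVal (addr c₀)) L₁≡) (addrVal-cong (suc (suc l)) (Describes.addr≗ at))))
        (readInput-setOne-≡ (zeros n) (subst (candidate ps <_) (sym (length-replicate n)) d<n)))

-- The lower bound

remQuot-injective : ∀ {m} n {i i′ : Fin (m * n)} → remQuot {m} n i ≡ remQuot n i′ → i ≡ i′
remQuot-injective {m} n {i} {i′} eq =
  trans (sym (combine-remQuot {m} n i)) (trans (cong (λ x → combine (proj₁ x) (proj₂ x)) eq) (combine-remQuot {m} n i′))

module Blocks (B : ℕ) where

  -- The j digits of i in base B, the t-th one placed in the block [p + t B, p + (t + 1) B).
  positions : ∀ j → ℕ → Fin (B ^ j) → List ℕ
  positions zero    p _ = []
  positions (suc j) p i = p + toℕ (Fin.quotient {B} (B ^ j) i) ∷ positions j (p + B) (Fin.remainder {B} (B ^ j) i)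

  positions-≥ : ∀ j p {y} i → y ≤ p → All (y ≤_) (positions j p i)
  positions-≥ zero    p i y≤p = []
  positions-≥ (suc j) p i y≤p = ≤-trans y≤p (m≤m+n p _) ∷ positions-≥ j (p + B) _ (≤-trans y≤p (m≤m+n p B))

  positions-ascending : ∀ j p U i → p + suc j * B ≤ U → Ascending p U j (positions (suc j) p i)
  positions-ascending zero    p U i end =
    single (m≤m+n p _) (≤-trans (+-monoʳ-< p (toℕ<n _)) (subst (λ x → p + x ≤ U) (+-identityʳ B) end))
  positions-ascending (suc j) p U i end =
    cons (m≤m+n p _) (Ascending-weaken (+-monoʳ-< p (toℕ<n _))
      (positions-ascending j (p + B) U _ (subst (_≤ U) (sym (+-assoc p B (suc j * B))) end)))

  setOnes-first-block : ∀ j p a i {x} → x < p + B →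
    setOnes (positions (suc j) p i) a x ≡ update a (p + toℕ (Fin.quotient {B} (B ^ j) i)) true x
  setOnes-first-block j p a i x<p+B = setOnes-below (positions j (p + B) _) _ (positions-≥ j (p + B) _ ≤-refl) x<p+B

  positions-injective : ∀ j p {a a′} (i i′ : Fin (B ^ j)) →
    (∀ x → p ≤ x → x < p + j * B → a x ≡ false) → (∀ x → p ≤ x → x < p + j * B → a′ x ≡ false) →
    (∀ x → p ≤ x → x < p + j * B → setOnes (positions j p i) a x ≡ setOnes (positions j p i′) a′ x) → i ≡ i′
  positions-injective zero p Fin.zero Fin.zero _ _ _ = refl
  positions-injective (suc j) p {a} {a′} i i′ blank blank′ agree =
    remQuot-injective {B} (B ^ j) (cong₂ _,_ (toℕ-injective f≡f′) rest≡)
    where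
      f  = toℕ (Fin.quotient {B} (B ^ j) i)
      f′ = toℕ (Fin.quotient {B} (B ^ j) i′)
      x₀<p+B : p + f < p + B
      x₀<p+B = +-monoʳ-< p (toℕ<n _)
      x₀<end : p + f < p + suc j * B
      x₀<end = ≤-trans x₀<p+B (+-monoʳ-≤ p (m≤m+n B _))
      f≡f′ : f ≡ f′
      f≡f′ with f ≟ f′
      ... | yes f≡f′ = f≡f′
      ... | no f≢f′  = contradiction (begin
          true                                     ≡⟨ sym (update-≡ a (p + f) true) ⟩
          update a (p + f) true (p + f)            ≡⟨ sym (setOnes-first-block j p a i x₀<p+B) ⟩
          setOnes (positions (suc j) p i) a (p + f)   ≡⟨ agree (p + f) (m≤m+n p f) x₀<end ⟩
          setOnes (positions (suc j) p i′) a′ (p + f) ≡⟨ setOnes-first-block j p a′ i′ x₀<p+B ⟩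
          update a′ (p + f′) true (p + f)          ≡⟨ update-≢ a′ true (f≢f′ ∘ +-cancelˡ-≡ p f f′) ⟩
          a′ (p + f)                               ≡⟨ blank′ (p + f) (m≤m+n p f) x₀<end ⟩
          false                                    ∎) (λ ())
        where open ≡-Reasoning
      inner : ∀ {x} → p + B ≤ x → x < p + B + j * B → p ≤ x × x < p + suc j * B
      inner {x} p+B≤x x<end = ≤-trans (m≤m+n p B) p+B≤x , subst (x <_) (+-assoc p B (j * B)) x<end
      blank-after : ∀ {t y} → y < p + B → (∀ x → p ≤ x → x < p + suc j * B → t x ≡ false) →
                    ∀ x → p + B ≤ x → x < p + B + j * B → update t y true x ≡ false
      blank-after y<p+B blankₜ x l u = trans (update-≢ _ true (≢-sym (<⇒≢ (<-≤-trans y<p+B l)))) (uncurry (blankₜ x) (inner l u))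
      rest≡ : Fin.remainder {B} (B ^ j) i ≡ Fin.remainder {B} (B ^ j) i′
      rest≡ = positions-injective j (p + B) {update a (p + f) true} {update a′ (p + f′) true} _ _
        (blank-after x₀<p+B blank) (blank-after (+-monoʳ-< p (toℕ<n _)) blank′) (λ x l u → uncurry (agree x) (inner l u))

-- Blocks of width B = D + 1 on an address tape of length L = (k + 1) B + 1 give B^(k+1) candidate
-- addresses, more than the c L^k + c steps of a machine running in time c log^k n + c.
steps<choices : ∀ k c → let D = c * (2 * suc k) ^ k + c in
                c * suc (suc (D + k * suc D)) ^ k + c < suc D ^ suc k
steps<choices k c = begin-strict
    c * L ^ k + c
  ≤⟨ +-mono-≤ (*-monoʳ-≤ c (≤-trans (^-monoˡ-≤ k L≤) (≤-reflexive (^-distribʳ-* (2 * suc k) B k))))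
              (subst (_≤ c * B ^ k) (*-identityʳ c) (*-monoʳ-≤ c (1≤^ k (s≤s z≤n)))) ⟩
    c * ((2 * suc k) ^ k * B ^ k) + c * B ^ k
  ≡⟨ factor c ((2 * suc k) ^ k) (B ^ k) ⟩
    D * B ^ k
  <⟨ m<n+m (D * B ^ k) (1≤^ k (s≤s z≤n)) ⟩
    B ^ k + D * B ^ k
  ∎
  where
    open ≤-Reasoning
    D = c * (2 * suc k) ^ k + c
    B = suc D
    L = suc (suc (D + k * suc D))
    L≤ : L ≤ 2 * suc k * B
    L≤ = subst (L ≤_) (sym (*-assoc 2 (suc k) B))
               (≤-trans (s≤s (s≤s (m≤m+n _ _))) (≤-reflexive (sym (double (D + k * suc D)))))
      where
        double : ∀ x → 2 * suc x ≡ suc (suc (x + x))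
        double = solve-∀
    factor : ∀ c x y → c * (x * y) + c * y ≡ (c * x + c) * y
    factor = solve-∀

unqueried : ∀ {N T} (φ : Fin N → ℕ) → (∀ {i j} → φ i ≡ φ j → i ≡ j) → T < N → (q : ℕ → ℕ) →
            ∃ λ i → ∀ s → s < T → q s ≢ φ i
unqueried {N} {T} φ φ-injective T<N q =
  proj₁ missed , λ s s<T q≡ → proj₂ missed (fromℕ< s<T , trans (cong q (toℕ-fromℕ< s<T)) q≡)
  where
    Hit : Fin N → Set
    Hit i = Σ (Fin T) λ s → q (toℕ s) ≡ φ i
    notAll : ¬ (∀ i → Hit i)
    notAll hit with pigeonhole T<N (proj₁ ∘ hit)
    ... | i , j , i<j , s≡ =
      <-irrefl (cong toℕ (φ-injective (trans (sym (proj₂ (hit i))) (trans (cong (q ∘ toℕ) s≡) (proj₂ (hit j)))))) i<j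
    missed = ¬∀⟶∃¬ N Hit (λ i → any? λ s → q (toℕ s) ≟ φ i) notAll

module LowerBound (k : ℕ) where
  open Machine k
  open Runs using (readAt; HaltsWithin-indistinguishable)
  open Config

  language∉DTIME : ¬ DTIME (logPow k) language
  language∉DTIME (M , c , decides) =
    contradiction (trans (sym (language-candidate n l L≡ ascending d<n)) (trans same (language-zeros n))) λ ()
    where
      D = c * (2 * suc k) ^ k + c
      width = suc D
      l = D + k * width
      L = suc (suc l)
      n = 2 ^ L
      budget = c * L ^ k + c
      w₀ = zeros n

      L≡ : addrLength w₀ ≡ L
      L≡ = trans (addrLength-zeros n) (⌈log₂2^n⌉≡n L)

      open OnZeros.LongTape n l L≡ using (a*; seg*; candidate)
      open Blocks width

      address : Fin (width ^ suc k) → ℕ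
      address i = candidate (positions (suc k) 0 i)

      address-injective : ∀ {i j} → address i ≡ address j → i ≡ j
      address-injective eq = positions-injective (suc k) 0 _ _ blank blank
        (λ x _ x<1+l → addrVal-injective L _ _ eq (<-trans x<1+l (n<1+n _)))
        where
          blank : ∀ x → 0 ≤ x → x < suc l → a* x ≡ false
          blank x _ = Segment.zero-at seg* x

      queried : ℕ → ℕ
      queried s = addrVal (addr (run M w₀ s)) (addrLength w₀)

      missed = unqueried address address-injective (steps<choices k c) queried
      ascending = positions-ascending k 0 (suc l) (proj₁ missed) ≤-refl
      d = address (proj₁ missed)
      w₁ = setOne w₀ d

      d<n : d < n
      d<n = addrVal-< _ L

      len : length w₁ ≡ length w₀
      len = length-setOne w₀ d

      decidesWithin : ∀ w → addrLength w ≡ L → HaltsWithin M w budget (language w)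
      decidesWithin w L≡′ = subst (λ t → HaltsWithin M w t (language w)) (cong (λ x → c * x ^ k + c) L≡′) (decides w)

      agree : ∀ s → s < budget → readAt M w₁ (run M w₀ s) ≡ readAt M w₀ (run M w₀ s)
      agree s s<budget = trans (cong (λ L′ → readInput w₁ (addrVal (addr (run M w₀ s)) L′)) (cong ⌈log₂_⌉ len))
                               (readInput-setOne-≢ w₀ (proj₂ missed s s<budget))

      same : language w₁ ≡ language w₀
      same = HaltsWithin-indistinguishable M len agree
        (decidesWithin w₁ (trans (cong ⌈log₂_⌉ len) L≡)) (decidesWithin w₀ L≡)

DTIME-mono : ∀ {f g : ℕ → ℕ} → (∀ n → f n ≤ g n) → ∀ L → DTIME f L → DTIME g L
DTIME-mono {f} {g} f≤g L (M , c , decides) = M , c , λ w → weaken (decides w)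
  where
    weaken : ∀ {w b} → HaltsWithin M w (c * f (length w) + c) b → HaltsWithin M w (c * g (length w) + c) b
    weaken {w} (s , s≤ , halts , answer) = s , ≤-trans s≤ (+-monoˡ-≤ c (*-monoʳ-≤ c (f≤g (length w)))) , halts , answer

logPow-mono : ∀ k → 1 ≤ k → ∀ n → logPow k n ≤ logPow (suc k) n
logPow-mono (suc k) _ n = ^-≤-^suc ⌈log₂ n ⌉
  where
    ^-≤-^suc : ∀ x → x ^ suc k ≤ x ^ suc (suc k)
    ^-≤-^suc zero    = z≤n
    ^-≤-^suc (suc x) = m≤n*m (suc x ^ suc k) (suc x)

theorem1 : ∀ (k : ℕ) → 1 < k →
    (∀ (L : Language) → DTIME (logPow k) L → DTIME (logPow (suc k)) L)
    × Σ Language (λ L → DTIME (logPow (suc k)) L × ¬ DTIME (logPow k) L)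
theorem1 k 1<k =
  DTIME-mono (logPow-mono k (<⇒≤ 1<k)) ,
  (Machine.language k , Machine.language∈DTIME k , LowerBound.language∉DTIME k)
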